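{- For integers $\delta \geq 2$ and $g \geq 3$, let $f(g,\delta)$ denote the minimum number of vertices of a graph with girth at least $g$ and minimum degree $\delta$. Then for every integer $r > \frac{g}{2}$ there exists a connected graph on $n = \left\lceil \frac{2r}{g}\right\rceil f(g,\delta)$ vertices with girth at least $g$, minimum degree $\delta$ and radius at least $r$.
   Context: Graphs are finite and simple. The girth of a graph is the length of its shortest cycle (infinite if acyclic). The radius of a connected graph $G$ is $\min_v \max_w d(v,w)$, with $d$ the graph distance. -}

module Defs where

open import Data.Nat using (ℕ; zero; suc; _+_; _*_; _≤_; _<_; _/_)
open import Data.Bool using (Bool; true; false; T)
open import Data.Fin using (Fin; zero; suc; inject₁; fromℕ)
open import Data.List using (length; filterᵇ; allFin)
open import Data.Product using (Σ; ∃; _×_)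
open import Relation.Nullary using (¬_)
open import Relation.Binary.PropositionalEquality using (_≡_)
open import Function.Definitions using (Injective)

record Graph (n : ℕ) : Set where
  field
    adj   : Fin n → Fin n → Bool
    sym   : ∀ v w → adj v w ≡ adj w v
    irrefl : ∀ v → adj v v ≡ false
open Graph public

Adj : ∀ {n} → Graph n → Fin n → Fin n → Set
Adj G v w = T (adj G v w)

deg : ∀ {n} → Graph n → Fin n → ℕ
deg {n} G v = length (filterᵇ (adj G v) (allFin n))

MinDegree : ∀ {n} → Graph n → ℕ → Set
MinDegree {n} G δ = (∃ λ (v : Fin n) → deg G v ≡ δ) × (∀ (v : Fin n) → δ ≤ deg G v)

-- A cycle of length (suc m) in G: an injective cyclic sequence of vertices
-- c 0, c 1, ..., c m with consecutive vertices adjacent and c m adjacent to c 0.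
record Cycle {n : ℕ} (G : Graph n) (m : ℕ) : Set where
  field
    vtx   : Fin (suc m) → Fin n
    inj   : Injective _≡_ _≡_ vtx
    step  : ∀ (i : Fin m) → Adj G (vtx (inject₁ i)) (vtx (suc i))
    close : Adj G (vtx (fromℕ m)) (vtx zero)

GirthAtLeast : ∀ {n} → Graph n → ℕ → Set
GirthAtLeast G g = ∀ (m : ℕ) → 3 ≤ suc m → suc m < g → ¬ Cycle G m

data Walk {n : ℕ} (G : Graph n) : Fin n → Fin n → ℕ → Set where
  here : ∀ {v} → Walk G v v 0
  step : ∀ {u v w k} → Adj G u v → Walk G v w k → Walk G u w (suc k)

Connected : ∀ {n} → Graph n → Set
Connected {n} G = ∀ (v w : Fin n) → ∃ λ k → Walk G v w k

DistAtLeast : ∀ {n} → Graph n → Fin n → Fin n → ℕ → Set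
DistAtLeast G v w r = ∀ k → k < r → ¬ Walk G v w k

-- radius ≥ r : min_v max_w d(v,w) ≥ r, i.e. every vertex has eccentricity ≥ r.
RadiusAtLeast : ∀ {n} → Graph n → ℕ → Set
RadiusAtLeast {n} G r = ∀ (v : Fin n) → ∃ λ (w : Fin n) → DistAtLeast G v w r

IsF : ℕ → ℕ → ℕ → Set
IsF g δ m =
  (Σ (Graph m) λ G → GirthAtLeast G g × MinDegree G δ) ×
  (∀ (n : ℕ) (G : Graph n) → GirthAtLeast G g → MinDegree G δ → m ≤ n)

-- ceiling division ⌈a / b⌉ (b > 0; value 0 for b = 0, never used)
ceilDiv : ℕ → ℕ → ℕ
ceilDiv a zero = 0
ceilDiv a (suc b) = (a + b) / suc b

module Submission where

-- A minimal graph G (girth ≥ g, minimum degree δ ≥ 2, f(g,δ) vertices) is connected, since a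
-- component containing a vertex of degree δ would be a smaller such graph, and it has an edge uv
-- on a cycle. Take k = ⌈2r/g⌉ copies of G and reroute uv from copy i to copy i + 1 (mod k): the
-- result is connected with the same degrees. With h = min (g − 1, dist_{G−uv} (v, ·)), the vertex
-- (i , x) is placed at i g + h x on the cycle ℤ/kgℤ, and adjacent vertices land at most 1 apart.
-- A cycle shorter than g either projects to a cycle of G or joins two copies of one vertex in
-- fewer than g steps, which the placement forbids; and since kg ≥ 2r, the vertex placed
-- opposite to any given vertex is at distance at least r from it.

open import Data.Bool using (Bool; true; false; _∧_; _∨_; not; T; if_then_else_)
open import Data.Bool.ListAction using (any)
open import Data.Bool.Properties using (T-∧; T-∨; T-≡; ∧-zeroʳ; ∧-identityʳ)
open import Data.Empty using (⊥; ⊥-elim)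
open import Data.Fin using (Fin; zero; suc; toℕ; _↑ˡ_; _↑ʳ_; combine; remQuot; inject₁; fromℕ; fromℕ<)
open import Data.Fin.Properties
  using (_≟_; any?; suc-injective; toℕ-injective; toℕ<n; toℕ-fromℕ; toℕ-fromℕ<; fromℕ<-toℕ; toℕ-inject₁;
         injective⇒≤; pigeonhole; remQuot-combine; combine-remQuot)
open import Data.List using (length; filterᵇ; tabulate; allFin)
open import Data.List.Membership.Propositional using (lose)
open import Data.List.Membership.Propositional.Properties using (∈-allFin)
open import Data.List.Relation.Unary.Any using (satisfied)
open import Data.List.Relation.Unary.Any.Properties using (any⁺; any⁻)
open import Data.Nat
  using (ℕ; zero; suc; _+_; _*_; _∸_; ∣_-_∣; _≤_; _<_; z≤n; s≤s; z<s; s≤s⁻¹; _<?_; _≤?_)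
  renaming (_≟_ to _≟ℕ_)
open import Data.Nat.DivMod
  using (_%_; _/_; [m+kn]%n≡m%n; m<n⇒m%n≡m; m%n<n; m≡m%n+[m/n]*n; m<n*o⇒m/o<n)
open import Data.Nat.Induction using (<-wellFounded)
open import Data.Nat.Properties
  using (≤-refl; ≤-trans; ≤-reflexive; ≤-antisym; <⇒≤; <-≤-trans; <-trans; <-irrefl; <-cmp; <⇒≱; ≰⇒>;
         ≮⇒≥; ≤∧≢⇒<; n≤0⇒n≡0; n≤1+n; n<1+n; m≤n⇒m≤1+n; m≤n⇒m<n∨m≡n; m≤m+n; m<m+n; m∸n≤m; m+[n∸m]≡n;
         +-assoc; +-comm; +-suc; +-identityʳ; +-mono-≤; +-monoˡ-≤; +-monoʳ-≤; +-monoˡ-<;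
         +-cancelˡ-≤; +-cancelʳ-≤; *-monoˡ-≤;
         ∣n-n∣≡0; ∣-∣-comm; ∣m-m+n∣≡n; ∣m+n-m+o∣≡∣n-o∣; ∣-∣-triangle; ∣m-n∣≡0⇒m≡n; *-distribʳ-∣-∣;
         m≤n+∣n-m∣; m≤n+∣m-n∣; module ≤-Reasoning; +-0-commutativeMonoid)
open import Data.Nat.Solver using (module +-*-Solver)
open import Data.Product using (Σ; ∃; ∃₂; _×_; _,_; proj₁; proj₂)
open import Data.Sum using (_⊎_; inj₁; inj₂)
open import Defs hiding (sym)
open import Function using (_∘_; _⇔_; Equivalence; mk⇔)
open import Function.Definitions using (Injective)
open import Function.Properties.Equivalence using () renaming (sym to ⇔-sym)
open import Induction.WellFounded using (Acc; acc)
open import Relation.Binary.Definitions using (tri<; tri≈; tri>)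
open import Relation.Binary.PropositionalEquality hiding (J)
open import Relation.Nullary using (¬_; Dec; yes; no; does; isYes; ¬?)
open import Relation.Nullary.Decidable using (_×-dec_; _⊎-dec_; does-⇔; T?; toWitness; fromWitness)

open +-*-Solver using (solve; _:+_; _:*_; _:=_; con)
open import Algebra.Properties.CommutativeMonoid.Sum +-0-commutativeMonoid using (sum; sum-cong-≗; ∑-comm)

bit : Bool → ℕ
bit true  = 1
bit false = 0

count : ∀ {n} → (Fin n → Bool) → ℕ
count p = sum (bit ∘ p)

sum-mono-≤ : ∀ {n} {h h′ : Fin n → ℕ} → (∀ i → h i ≤ h′ i) → sum h ≤ sum h′
sum-mono-≤ {zero}  e = z≤n
sum-mono-≤ {suc n} e = +-mono-≤ (e zero) (sum-mono-≤ (e ∘ suc))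

sum-↑ : ∀ m {n} (h : Fin (m + n) → ℕ) → sum h ≡ sum (h ∘ (_↑ˡ n)) + sum (h ∘ (m ↑ʳ_))
sum-↑ zero    h = refl
sum-↑ (suc m) h = trans (cong (h zero +_) (sum-↑ m (h ∘ suc))) (sym (+-assoc (h zero) _ _))

sum-combine : ∀ m {n} (h : Fin (m * n) → ℕ) →
  sum h ≡ sum {m} (λ i → sum {n} (λ j → h (combine i j)))
sum-combine zero        h = refl
sum-combine (suc m) {n} h =
  trans (sum-↑ n h) (cong (sum (λ j → h (j ↑ˡ (m * n))) +_) (sum-combine m (h ∘ (n ↑ʳ_))))

count-false : ∀ n → count {n} (λ _ → false) ≡ 0
count-false zero    = refl
count-false (suc n) = count-false n

count-≡ : ∀ {n} (c : Fin n) → count (λ i → does (i ≟ c)) ≡ 1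
count-≡ {suc n} zero    = cong suc (count-false n)
count-≡ {suc n} (suc c) = count-≡ c

count≤n : ∀ {n} (p : Fin n → Bool) → count p ≤ n
count≤n {zero}  p = z≤n
count≤n {suc n} p with p zero
... | true  = s≤s (count≤n (p ∘ suc))
... | false = m≤n⇒m≤1+n (count≤n (p ∘ suc))

count<n : ∀ {n} (p : Fin n → Bool) (x : Fin n) → ¬ T (p x) → count p < n
count<n {suc n} p zero    ¬px with p zero
... | true  = ⊥-elim (¬px _)
... | false = s≤s (count≤n (p ∘ suc))
count<n {suc n} p (suc x) ¬px with p zero
... | true  = s≤s (count<n (p ∘ suc) x ¬px)
... | false = m≤n⇒m≤1+n (count<n (p ∘ suc) x ¬px)

length-filterᵇ-tabulate : ∀ {A : Set} {n} (q : A → Bool) (h : Fin n → A) →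
  length (filterᵇ q (tabulate h)) ≡ count (q ∘ h)
length-filterᵇ-tabulate {n = zero}  q h = refl
length-filterᵇ-tabulate {n = suc n} q h with q (h zero)
... | true  = cong suc (length-filterᵇ-tabulate q (h ∘ suc))
... | false = length-filterᵇ-tabulate q (h ∘ suc)

deg≡count : ∀ {n} (G : Graph n) (x : Fin n) → deg G x ≡ count (adj G x)
deg≡count G x = length-filterᵇ-tabulate (adj G x) (λ y → y)

-- If no other element satisfies p, then p is dominated pointwise by the indicator of z.
count≥2⇒∃-other : ∀ {n} (p : Fin n → Bool) → 2 ≤ count p → (z : Fin n) → ∃ λ y → y ≢ z × T (p y)
count≥2⇒∃-other p 2≤ z with any? (λ y → ¬? (y ≟ z) ×-dec T? (p y))
... | yes found = found
... | no none = ⊥-elim (<⇒≱ (s≤s (s≤s z≤n))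
        (≤-trans 2≤ (≤-trans (sum-mono-≤ dominated) (≤-reflexive (count-≡ z)))))
  where
  dominated : ∀ y → bit (p y) ≤ bit (does (y ≟ z))
  dominated y with y ≟ z | p y in py
  ... | yes _ | true  = ≤-refl
  ... | yes _ | false = z≤n
  ... | no  _ | false = z≤n
  ... | no y≢z | true = ⊥-elim (none (y , y≢z , Equivalence.from T-≡ py))

enumerate : ∀ {n} (p : Fin n → Bool) → Fin (count p) → Fin n
enumerate {suc n} p j with p zero
enumerate {suc n} p zero    | true  = zero
enumerate {suc n} p (suc j) | true  = suc (enumerate (p ∘ suc) j)
enumerate {suc n} p j       | false = suc (enumerate (p ∘ suc) j)

enumerate-T : ∀ {n} (p : Fin n → Bool) j → T (p (enumerate p j))
enumerate-T {suc n} p j with p zero in p0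
enumerate-T {suc n} p zero    | true  = Equivalence.from T-≡ p0
enumerate-T {suc n} p (suc j) | true  = enumerate-T (p ∘ suc) j
enumerate-T {suc n} p j       | false = enumerate-T (p ∘ suc) j

enumerate-injective : ∀ {n} (p : Fin n → Bool) → Injective _≡_ _≡_ (enumerate p)
enumerate-injective {suc n} p {i} {j} e with p zero
enumerate-injective {suc n} p {zero}  {zero}  e | true  = refl
enumerate-injective {suc n} p {suc i} {suc j} e | true  =
  cong suc (enumerate-injective (p ∘ suc) (suc-injective e))
enumerate-injective {suc n} p {i}     {j}     e | false = enumerate-injective (p ∘ suc) (suc-injective e)

enumerate-surjective : ∀ {n} (p : Fin n → Bool) x → T (p x) → ∃ λ j → enumerate p j ≡ x
enumerate-surjective {suc n} p x px with p zero in p0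
enumerate-surjective {suc n} p zero    px | true  = zero , refl
enumerate-surjective {suc n} p zero    px | false = ⊥-elim (subst T p0 px)
enumerate-surjective {suc n} p (suc x) px | true  with enumerate-surjective (p ∘ suc) x px
... | j , e = suc j , cong suc e
enumerate-surjective {suc n} p (suc x) px | false with enumerate-surjective (p ∘ suc) x px
... | j , e = j , cong suc e

count-∘-enumerate : ∀ {n} (p q : Fin n → Bool) → count (q ∘ enumerate p) ≡ count (λ x → p x ∧ q x)
count-∘-enumerate {zero}  p q = refl
count-∘-enumerate {suc n} p q with p zero
... | true  = cong (bit (q zero) +_) (count-∘-enumerate (p ∘ suc) (q ∘ suc))
... | false = count-∘-enumerate (p ∘ suc) (q ∘ suc)

injective⊎collision : ∀ {m n} (F : Fin m → Fin n) →
  Injective _≡_ _≡_ F ⊎ ∃₂ λ i j → toℕ i < toℕ j × F i ≡ F j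
injective⊎collision {m} F with any? (λ i → any? (λ j → (toℕ i <? toℕ j) ×-dec (F i ≟ F j)))
... | yes collision    = inj₂ collision
... | no  noCollision = inj₁ injective
  where
  injective : Injective _≡_ _≡_ F
  injective {i} {j} Fi≡Fj with <-cmp (toℕ i) (toℕ j)
  ... | tri< i<j _ _ = ⊥-elim (noCollision (i , j , i<j , Fi≡Fj))
  ... | tri≈ _ i≡j _ = toℕ-injective i≡j
  ... | tri> _ _ j<i = ⊥-elim (noCollision (j , i , j<i , sym Fi≡Fj))

¬T⇒T-not : ∀ {b} → ¬ T b → T (not b)
¬T⇒T-not {false} _  = _
¬T⇒T-not {true}  ¬b = ¬b _

T⇒¬T-not : ∀ {b} → T b → ¬ T (not b)
T⇒¬T-not {true} _ ()

T-does⇒ : ∀ {A : Set} (a? : Dec A) → T (does a?) → A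
T-does⇒ (yes a) _ = a

⇒T-does : ∀ {A : Set} (a? : Dec A) → A → T (does a?)
⇒T-does (yes _) _ = _
⇒T-does (no ¬a) a = ¬a a

T-not-does⇒¬ : ∀ {A : Set} (a? : Dec A) → T (not (does a?)) → ¬ A
T-not-does⇒¬ (no ¬a) _ = ¬a

¬⇒T-not-does : ∀ {A : Set} (a? : Dec A) → ¬ A → T (not (does a?))
¬⇒T-not-does (yes a) ¬a = ¬a a
¬⇒T-not-does (no  _) _  = _

Adj-sym : ∀ {n} (G : Graph n) {x y} → Adj G x y → Adj G y x
Adj-sym G {x} {y} = subst T (Graph.sym G x y)

module _ {n : ℕ} {G : Graph n} where

  castʷ : ∀ {a a′ b b′ ℓ} → a ≡ a′ → b ≡ b′ → Walk G a b ℓ → Walk G a′ b′ ℓ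
  castʷ refl refl w = w

  _++ʷ_ : ∀ {a b c ℓ ℓ′} → Walk G a b ℓ → Walk G b c ℓ′ → Walk G a c (ℓ + ℓ′)
  here     ++ʷ w′ = w′
  step e w ++ʷ w′ = step e (w ++ʷ w′)

  _∷ʳʷ_ : ∀ {a b c ℓ} → Walk G a b ℓ → Adj G b c → Walk G a c (suc ℓ)
  here     ∷ʳʷ e′ = step e′ here
  step e w ∷ʳʷ e′ = step e (w ∷ʳʷ e′)

  reverseʷ : ∀ {a b ℓ} → Walk G a b ℓ → Walk G b a ℓ
  reverseʷ here       = here
  reverseʷ (step e w) = reverseʷ w ∷ʳʷ Adj-sym G e

  -- Beyond the end of the walk, vertex returns the last vertex.
  vertex : ∀ {a b ℓ} → Walk G a b ℓ → ℕ → Fin n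
  vertex {a} here       t       = a
  vertex {a} (step e w) zero    = a
  vertex {a} (step e w) (suc t) = vertex w t

  vertices : ∀ {a b ℓ} → Walk G a b ℓ → Fin (suc ℓ) → Fin n
  vertices w = vertex w ∘ toℕ

  IsPath : ∀ {a b ℓ} → Walk G a b ℓ → Set
  IsPath w = Injective _≡_ _≡_ (vertices w)

  vertex-0 : ∀ {a b ℓ} (w : Walk G a b ℓ) → vertex w 0 ≡ a
  vertex-0 here       = refl
  vertex-0 (step e w) = refl

  vertex-end : ∀ {a b ℓ} (w : Walk G a b ℓ) t → ℓ ≤ t → vertex w t ≡ b
  vertex-end here       t       ℓ≤t       = refl
  vertex-end (step e w) (suc t) (s≤s ℓ≤t) = vertex-end w t ℓ≤t

  vertex-Adj : ∀ {a b ℓ} (w : Walk G a b ℓ) t → t < ℓ → Adj G (vertex w t) (vertex w (suc t))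
  vertex-Adj (step e w) zero    _         = subst (Adj G _) (sym (vertex-0 w)) e
  vertex-Adj (step e w) (suc t) (s≤s t<ℓ) = vertex-Adj w t t<ℓ

walkAlong : ∀ {n} (G : Graph n) (V : ℕ → Fin n) a d →
  (∀ t → a ≤ t → t < a + d → Adj G (V t) (V (suc t))) → Walk G (V a) (V (a + d)) d
walkAlong G V a zero    _    = castʷ refl (cong V (sym (+-identityʳ a))) here
walkAlong G V a (suc d) Adj-V = step (Adj-V a ≤-refl (m<m+n a z<s))
  (castʷ refl (cong V (sym (+-suc a d)))
    (walkAlong G V (suc a) d λ t a<t t<a+d → Adj-V t (<⇒≤ a<t) (subst (t <_) (sym (+-suc a d)) t<a+d)))

module _ {n : ℕ} {G : Graph n} where

  shortcut : ∀ {a b ℓ} (w : Walk G a b ℓ) t₁ t₂ → t₁ < t₂ → t₂ ≤ ℓ → vertex w t₁ ≡ vertex w t₂ →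
             ∃ λ ℓ′ → ℓ′ < ℓ × Walk G a b ℓ′
  shortcut {a} {b} {ℓ} w t₁ t₂ t₁<t₂ t₂≤ℓ loop =
    t₁ + (ℓ ∸ t₂) , shorter ,
    castʷ (vertex-0 w) (vertex-end w (t₂ + (ℓ ∸ t₂)) (≤-reflexive (sym (m+[n∸m]≡n t₂≤ℓ))))
      (castʷ refl loop before ++ʷ after)
    where
    before : Walk G (vertex w 0) (vertex w t₁) t₁
    before = walkAlong G (vertex w) 0 t₁ λ t _ t<t₁ →
      vertex-Adj w t (<-≤-trans t<t₁ (≤-trans (<⇒≤ t₁<t₂) t₂≤ℓ))
    after : Walk G (vertex w t₂) (vertex w (t₂ + (ℓ ∸ t₂))) (ℓ ∸ t₂)
    after = walkAlong G (vertex w) t₂ (ℓ ∸ t₂) λ t _ t<ℓ →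
      vertex-Adj w t (<-≤-trans t<ℓ (≤-reflexive (m+[n∸m]≡n t₂≤ℓ)))
    shorter : t₁ + (ℓ ∸ t₂) < ℓ
    shorter = <-≤-trans (+-monoˡ-< (ℓ ∸ t₂) t₁<t₂) (≤-reflexive (m+[n∸m]≡n t₂≤ℓ))

  walk⇒path : ∀ {a b ℓ} → Walk G a b ℓ → ∃ λ ℓ′ → ℓ′ ≤ ℓ × Σ (Walk G a b ℓ′) IsPath
  walk⇒path w = go w (<-wellFounded _)
    where
    go : ∀ {a b ℓ} → Walk G a b ℓ → Acc _<_ ℓ → ∃ λ ℓ′ → ℓ′ ≤ ℓ × Σ (Walk G a b ℓ′) IsPath
    go {ℓ = ℓ} w (acc shorter) with injective⊎collision (vertices w)
    ... | inj₁ isPath = ℓ , ≤-refl , w , isPath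
    ... | inj₂ (i , j , i<j , loop) with shortcut w (toℕ i) (toℕ j) i<j (s≤s⁻¹ (toℕ<n j)) loop
    ...   | ℓ₁ , ℓ₁<ℓ , w₁ with go w₁ (shorter ℓ₁<ℓ)
    ...     | ℓ₂ , ℓ₂≤ℓ₁ , path = ℓ₂ , ≤-trans ℓ₂≤ℓ₁ (<⇒≤ ℓ₁<ℓ) , path

  path⇒cycle : ∀ {a b ℓ} (w : Walk G a b ℓ) → IsPath w → Adj G b a → Cycle G ℓ
  path⇒cycle {a} {b} {ℓ} w path ba = record
    { vtx   = vertices w
    ; inj   = path
    ; step  = λ i → subst (λ t → Adj G (vertex w t) (vertex w (suc (toℕ i))))
                      (sym (toℕ-inject₁ i)) (vertex-Adj w (toℕ i) (toℕ<n i))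
    ; close = subst₂ (Adj G) (sym (trans (cong (vertex w) (toℕ-fromℕ ℓ)) (vertex-end w ℓ ≤-refl)))
                (sym (vertex-0 w)) ba
    }

  clamp : ∀ m → ℕ → Fin (suc m)
  clamp m t with t ≤? m
  ... | yes t≤m = fromℕ< (s≤s t≤m)
  ... | no  _   = fromℕ m

  toℕ-clamp : ∀ m t → t ≤ m → toℕ (clamp m t) ≡ t
  toℕ-clamp m t t≤m with t ≤? m
  ... | yes _   = toℕ-fromℕ< _
  ... | no  t≰m = ⊥-elim (t≰m t≤m)

  cycle-segment : ∀ {m} (C : Cycle G m) (i j : Fin (suc m)) → toℕ i ≤ toℕ j →
                  Walk G (Cycle.vtx C i) (Cycle.vtx C j) (toℕ j ∸ toℕ i)
  cycle-segment {m} C i j i≤j =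
    castʷ (cong vtx (toℕ-injective (toℕ-clamp m (toℕ i) (s≤s⁻¹ (toℕ<n i)))))
          (cong vtx (toℕ-injective (trans (toℕ-clamp m _ i+[j∸i]≤m) (m+[n∸m]≡n i≤j))))
          (walkAlong G (vtx ∘ clamp m) (toℕ i) (toℕ j ∸ toℕ i) along)
    where
    open Cycle C using (vtx)
    i+[j∸i]≤m : toℕ i + (toℕ j ∸ toℕ i) ≤ m
    i+[j∸i]≤m = ≤-trans (≤-reflexive (m+[n∸m]≡n i≤j)) (s≤s⁻¹ (toℕ<n j))
    along : ∀ t → toℕ i ≤ t → t < toℕ i + (toℕ j ∸ toℕ i) → Adj G (vtx (clamp m t)) (vtx (clamp m (suc t)))
    along t _ t<j = subst₂ (λ x y → Adj G (vtx x) (vtx y)) inject₁-k suc-k (Cycle.step C k)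
      where
      t<m : t < m
      t<m = <-≤-trans t<j i+[j∸i]≤m
      k : Fin m
      k = fromℕ< t<m
      inject₁-k : inject₁ k ≡ clamp m t
      inject₁-k = toℕ-injective
        (trans (toℕ-inject₁ k) (trans (toℕ-fromℕ< t<m) (sym (toℕ-clamp m t (<⇒≤ t<m)))))
      suc-k : suc k ≡ clamp m (suc t)
      suc-k = toℕ-injective (trans (cong suc (toℕ-fromℕ< t<m)) (sym (toℕ-clamp m (suc t) t<m)))

module _ {n : ℕ} (G : Graph n) where

  reachable≤ : Fin n → ℕ → Fin n → Bool
  reachable≤ a zero    y = does (a ≟ y)
  reachable≤ a (suc t) y = reachable≤ a t y ∨ any (λ x → reachable≤ a t x ∧ adj G x y) (allFin n)

  reachable≤-step : ∀ a t {x y} → T (reachable≤ a t x) → Adj G x y → T (reachable≤ a (suc t) y)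
  reachable≤-step a t {x} ax xy =
    Equivalence.from T-∨ (inj₂ (any⁺ _ (lose (∈-allFin x) (Equivalence.from T-∧ (ax , xy)))))

  reachable≤-mono : ∀ {a t t′ y} → t ≤ t′ → T (reachable≤ a t y) → T (reachable≤ a t′ y)
  reachable≤-mono {t′ = zero}   z≤n  ay = ay
  reachable≤-mono {t′ = suc t′} t≤t′ ay with m≤n⇒m<n∨m≡n t≤t′
  ... | inj₁ t<1+t′ = Equivalence.from T-∨ (inj₁ (reachable≤-mono (s≤s⁻¹ t<1+t′) ay))
  ... | inj₂ refl   = ay

  reachable≤-++ : ∀ {a t x y ℓ} → T (reachable≤ a t x) → Walk G x y ℓ → T (reachable≤ a (t + ℓ) y)
  reachable≤-++ {t = t} ax here = subst (λ s → T (reachable≤ _ s _)) (sym (+-identityʳ t)) ax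
  reachable≤-++ {a} {t} {y = y} {ℓ = suc ℓ} ax (step e w) =
    subst (λ s → T (reachable≤ a s y)) (sym (+-suc t ℓ))
          (reachable≤-++ {t = suc t} (reachable≤-step a t ax e) w)

  reachable≤-complete : ∀ {a y ℓ t} → ℓ ≤ t → Walk G a y ℓ → T (reachable≤ a t y)
  reachable≤-complete {a} ℓ≤t w = reachable≤-mono ℓ≤t (reachable≤-++ {t = 0} (⇒T-does (a ≟ a) refl) w)

  reachable≤-sound : ∀ {a} t {y} → T (reachable≤ a t y) → ∃ λ ℓ → ℓ ≤ t × Walk G a y ℓ
  reachable≤-sound {a} zero {y} ay with a ≟ y
  ... | yes refl = 0 , z≤n , here
  reachable≤-sound {a} (suc t) {y} ay with Equivalence.to T-∨ ay
  ... | inj₁ ay′ with reachable≤-sound t ay′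
  ...   | ℓ , ℓ≤t , w = ℓ , m≤n⇒m≤1+n ℓ≤t , w
  reachable≤-sound {a} (suc t) {y} ay | inj₂ viaX
    with satisfied (any⁻ (λ x → reachable≤ a t x ∧ adj G x y) (allFin n) viaX)
  ... | x , ax∧xy with Equivalence.to T-∧ ax∧xy
  ...   | ax , xy with reachable≤-sound t ax
  ...     | ℓ , ℓ≤t , w = suc ℓ , s≤s ℓ≤t , w ∷ʳʷ xy

  reachable : Fin n → Fin n → Bool
  reachable a = reachable≤ a n

  -- A path has at most n vertices.
  reachable-complete : ∀ {a y ℓ} → Walk G a y ℓ → T (reachable a y)
  reachable-complete w with walk⇒path w
  ... | ℓ′ , _ , path , isPath = reachable≤-complete (≤-trans (n≤1+n ℓ′) (injective⇒≤ isPath)) path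

  ClosedUnderAdj : (Fin n → Bool) → Set
  ClosedUnderAdj p = ∀ {x y} → T (p x) → Adj G x y → T (p y)

  reachable-closed : ∀ a → ClosedUnderAdj (reachable a)
  reachable-closed a ax xy with reachable≤-sound n ax
  ... | _ , _ , w = reachable-complete (w ∷ʳʷ xy)

  unreachable-closed : ∀ a → ClosedUnderAdj (not ∘ reachable a)
  unreachable-closed a ¬ax xy =
    ¬T⇒T-not λ ay → T⇒¬T-not (reachable-closed a ay (Adj-sym G xy)) ¬ax

  induced : (p : Fin n → Bool) → Graph (count p)
  induced p = record
    { adj    = λ a b → adj G (enumerate p a) (enumerate p b)
    ; sym    = λ a b → Graph.sym G (enumerate p a) (enumerate p b)
    ; irrefl = λ a → Graph.irrefl G (enumerate p a)
    }

  induced-girth : ∀ {g} p → GirthAtLeast G g → GirthAtLeast (induced p) g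
  induced-girth p girth m 3≤ <g C = girth m 3≤ <g record
    { vtx   = enumerate p ∘ Cycle.vtx C
    ; inj   = Cycle.inj C ∘ enumerate-injective p
    ; step  = Cycle.step C
    ; close = Cycle.close C
    }

  induced-deg : ∀ {p} → ClosedUnderAdj p → ∀ a → deg (induced p) a ≡ deg G (enumerate p a)
  induced-deg {p} closed a = begin
    deg (induced p) a                     ≡⟨ deg≡count (induced p) a ⟩
    count (adj G x ∘ enumerate p)         ≡⟨ count-∘-enumerate p (adj G x) ⟩
    count (λ y → p y ∧ adj G x y)         ≡⟨ sum-cong-≗ (cong bit ∘ p-redundant) ⟩
    count (adj G x)                       ≡⟨ deg≡count G x ⟨
    deg G x                               ∎
    where
    open ≡-Reasoning
    x = enumerate p a
    p-redundant : ∀ y → p y ∧ adj G x y ≡ adj G x y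
    p-redundant y with adj G x y in xy
    ... | true  = trans (∧-identityʳ (p y))
                        (Equivalence.to T-≡ (closed (enumerate-T p a) (Equivalence.from T-≡ xy)))
    ... | false = ∧-zeroʳ (p y)

  induced-minDegree : ∀ {δ p} → ClosedUnderAdj p → (∀ x → δ ≤ deg G x) →
    (x₀ : Fin n) → T (p x₀) → deg G x₀ ≡ δ → MinDegree (induced p) δ
  induced-minDegree {δ} {p} closed δ≤ x₀ px₀ deg-x₀ with enumerate-surjective p x₀ px₀
  ... | a₀ , refl = (a₀ , trans (induced-deg closed a₀) deg-x₀) ,
                    λ a → subst (δ ≤_) (sym (induced-deg closed a)) (δ≤ (enumerate p a))

-- If w is unreachable from v, the vertices reachable from v and the others are both
-- adjacency-closed proper subsets; the one containing a vertex of degree δ induces a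
-- smaller graph of girth ≥ g and minimum degree δ.
minimal⇒connected : ∀ {g δ f} (G : Graph f) → GirthAtLeast G g → MinDegree G δ →
  (∀ n (H : Graph n) → GirthAtLeast H g → MinDegree H δ → f ≤ n) → Connected G
minimal⇒connected {f = f} G girth ((x₀ , deg-x₀) , δ≤) minimal v w with T? (reachable G v w)
... | yes vw = let (ℓ , _ , walk) = reachable≤-sound G f vw in ℓ , walk
... | no ¬vw = ⊥-elim contradiction
  where
  smaller : ∀ {p} → ClosedUnderAdj G p → T (p x₀) → f ≤ count p
  smaller {p} closed px₀ =
    minimal _ (induced G p) (induced-girth G p girth) (induced-minDegree G closed δ≤ x₀ px₀ deg-x₀)
  contradiction : ⊥
  contradiction with T? (reachable G v x₀)
  ... | yes vx₀ = <⇒≱ (count<n (reachable G v) w ¬vw) (smaller (reachable-closed G v) vx₀)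
  ... | no ¬vx₀ = <⇒≱ (count<n (not ∘ reachable G v) v (T⇒¬T-not (reachable-complete G here)))
                      (smaller (unreachable-closed G v) (¬T⇒T-not ¬vx₀))

-- first b K is the least t < K with b t, and K if there is none.
first : (ℕ → Bool) → ℕ → ℕ
first b zero    = 0
first b (suc K) = if b 0 then 0 else suc (first (b ∘ suc) K)

first-≤ : ∀ b K → first b K ≤ K
first-≤ b zero    = z≤n
first-≤ b (suc K) with b 0
... | true  = z≤n
... | false = s≤s (first-≤ (b ∘ suc) K)

first-minimal : ∀ b K {t} → T (b t) → first b K ≤ t
first-minimal b zero    _  = z≤n
first-minimal b (suc K) {t} bt with b 0 in b0
first-minimal b (suc K) {t}     bt | true  = z≤n
first-minimal b (suc K) {zero}  bt | false = ⊥-elim (subst T b0 bt)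
first-minimal b (suc K) {suc t} bt | false = s≤s (first-minimal (b ∘ suc) K bt)

first-T : ∀ b K → first b K < K → T (b (first b K))
first-T b (suc K) first<K with b 0 in b0
... | true  = Equivalence.from T-≡ b0
... | false = first-T (b ∘ suc) K (s≤s⁻¹ first<K)

least-witness : ∀ {P : ℕ → Set} → (∀ t → Dec (P t)) → ∀ {K} → P K →
                ∃ λ J → P J × (∀ j → j < J → ¬ P j)
least-witness {P} P? {K} PK = J , PJ , λ j j<J Pj → <⇒≱ j<J (first-minimal b K (fromWitness Pj))
  where
  b = λ t → isYes (P? t)
  J = first b K
  PJ : P J
  PJ with m≤n⇒m<n∨m≡n (first-≤ b K)
  ... | inj₁ J<K = toWitness (first-T b K J<K)
  ... | inj₂ J≡K = subst P (sym J≡K) PK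

module _ {n : ℕ} where

  IsEdge : Fin n → Fin n → Fin n → Fin n → Set
  IsEdge u v x y = (x ≡ u × y ≡ v) ⊎ (x ≡ v × y ≡ u)

  IsEdge-sym : ∀ {u v x y} → IsEdge u v x y → IsEdge u v y x
  IsEdge-sym (inj₁ (x≡u , y≡v)) = inj₂ (y≡v , x≡u)
  IsEdge-sym (inj₂ (x≡v , y≡u)) = inj₁ (y≡u , x≡v)

  isEdge? : ∀ u v x y → Dec (IsEdge u v x y)
  isEdge? u v x y = (x ≟ u ×-dec y ≟ v) ⊎-dec (x ≟ v ×-dec y ≟ u)

  deleteEdge : Graph n → Fin n → Fin n → Graph n
  deleteEdge G u v = record
    { adj    = λ x y → adj G x y ∧ not (does (isEdge? u v x y))
    ; sym    = λ x y → cong₂ _∧_ (Graph.sym G x y)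
                         (cong not (does-⇔ (mk⇔ IsEdge-sym IsEdge-sym) (isEdge? u v x y) (isEdge? u v y x)))
    ; irrefl = λ x → cong (_∧ _) (Graph.irrefl G x)
    }

  module _ {G : Graph n} {u v : Fin n} where

    deleteEdge-Adj⁻ : ∀ {x y} → Adj (deleteEdge G u v) x y → Adj G x y × ¬ IsEdge u v x y
    deleteEdge-Adj⁻ {x} {y} xy with Equivalence.to T-∧ xy
    ... | Gxy , ¬e = Gxy , T-not-does⇒¬ (isEdge? u v x y) ¬e

    deleteEdge-Adj⁺ : ∀ {x y} → Adj G x y → ¬ IsEdge u v x y → Adj (deleteEdge G u v) x y
    deleteEdge-Adj⁺ {x} {y} Gxy ¬e = Equivalence.from T-∧ (Gxy , ¬⇒T-not-does (isEdge? u v x y) ¬e)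

    deleteEdge-⊆ : ∀ {a b ℓ} → Walk (deleteEdge G u v) a b ℓ → Walk G a b ℓ
    deleteEdge-⊆ here       = here
    deleteEdge-⊆ (step e w) = step (proj₁ (deleteEdge-Adj⁻ e)) (deleteEdge-⊆ w)

    vertex-deleteEdge-⊆ : ∀ {a b ℓ} (w : Walk (deleteEdge G u v) a b ℓ) t →
                          vertex (deleteEdge-⊆ w) t ≡ vertex w t
    vertex-deleteEdge-⊆ here       t       = refl
    vertex-deleteEdge-⊆ (step e w) zero    = refl
    vertex-deleteEdge-⊆ (step e w) (suc t) = vertex-deleteEdge-⊆ w t

    deleteEdge-⊆-IsPath : ∀ {a b ℓ} {w : Walk (deleteEdge G u v) a b ℓ} →
                          IsPath w → IsPath (deleteEdge-⊆ w)
    deleteEdge-⊆-IsPath {w = w} path {i} {j} e =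
      path (trans (sym (vertex-deleteEdge-⊆ w (toℕ i))) (trans e (vertex-deleteEdge-⊆ w (toℕ j))))

record EdgeOnCycle {n : ℕ} (G : Graph n) : Set where
  field
    u v  : Fin n
    uv   : Adj G u v
    len  : ℕ
    back : Walk (deleteEdge G u v) v u len

module NonBacktrackingWalk {n : ℕ} (G : Graph n) (2≤deg : ∀ x → 2 ≤ deg G x) (x₀ : Fin n) where

  otherNeighbour : (p c : Fin n) → ∃ λ y → y ≢ p × Adj G c y
  otherNeighbour p c = count≥2⇒∃-other (adj G c) (subst (2 ≤_) (deg≡count G c) (2≤deg c)) p

  -- lastTwo (suc t) = (W t , W (suc t))
  lastTwo : ℕ → Fin n × Fin n
  lastTwo zero    = x₀ , x₀
  lastTwo (suc t) = proj₂ (lastTwo t) , proj₁ (otherNeighbour (proj₁ (lastTwo t)) (proj₂ (lastTwo t)))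

  W : ℕ → Fin n
  W t = proj₂ (lastTwo t)

  W-Adj : ∀ t → Adj G (W t) (W (suc t))
  W-Adj t = proj₂ (proj₂ (otherNeighbour _ _))

  W-nonBacktracking : ∀ t → W (suc (suc t)) ≢ W t
  W-nonBacktracking t = proj₁ (proj₂ (otherNeighbour _ _))

-- Follow a non-backtracking walk W from x₀ until it first revisits a vertex, W J = W I
-- with I < J; then W I W (I+1) is an edge and W (I+1) … W J returns to W I without it.
edgeOnCycle : ∀ {n} (G : Graph n) → (∀ x → 2 ≤ deg G x) → Fin n → EdgeOnCycle G
edgeOnCycle {n} G 2≤deg x₀ =
  record { u = W I ; v = W (suc I) ; uv = W-Adj I ; len = J ∸ suc I ; back = back }
  where
  open NonBacktrackingWalk G 2≤deg x₀

  Revisits : ℕ → Set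
  Revisits J = ∃ λ (i : Fin J) → W (toℕ i) ≡ W J

  someRevisit : ∃ Revisits
  someRevisit with pigeonhole (≤-refl {suc n}) (W ∘ toℕ {suc n})
  ... | i , j , i<j , Wi≡Wj = toℕ j , fromℕ< i<j , trans (cong W (toℕ-fromℕ< i<j)) Wi≡Wj

  firstRevisit : ∃ λ J → Revisits J × (∀ j → j < J → ¬ Revisits j)
  firstRevisit = least-witness (λ J → any? λ (i : Fin J) → W (toℕ i) ≟ W J) (proj₂ someRevisit)

  J : ℕ
  J = proj₁ firstRevisit

  I : ℕ
  I = toℕ (proj₁ (proj₁ (proj₂ firstRevisit)))

  I<J : I < J
  I<J = toℕ<n (proj₁ (proj₁ (proj₂ firstRevisit)))

  WI≡WJ : W I ≡ W J
  WI≡WJ = proj₂ (proj₁ (proj₂ firstRevisit))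

  distinct : ∀ {a b} → a < b → b < J → W a ≢ W b
  distinct {a} {b} a<b b<J Wa≡Wb =
    proj₂ (proj₂ firstRevisit) b b<J (fromℕ< a<b , trans (cong W (toℕ-fromℕ< a<b)) Wa≡Wb)

  along : ∀ t → suc I ≤ t → t < suc I + (J ∸ suc I) → Adj (deleteEdge G (W I) (W (suc I))) (W t) (W (suc t))
  along t I<t t<J′ = deleteEdge-Adj⁺ {G = G} (W-Adj t) notTheEdge
    where
    t<J : t < J
    t<J = <-≤-trans t<J′ (≤-reflexive (m+[n∸m]≡n I<J))
    notTheEdge : ¬ IsEdge (W I) (W (suc I)) (W t) (W (suc t))
    notTheEdge (inj₁ (Wt≡WI , _)) = distinct I<t t<J (sym Wt≡WI)
    notTheEdge (inj₂ (Wt≡W1+I , W1+t≡WI)) with m≤n⇒m<n∨m≡n I<t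
    ... | inj₁ 1+I<t = distinct 1+I<t t<J (sym Wt≡W1+I)
    ... | inj₂ refl  = W-nonBacktracking I W1+t≡WI

  back : Walk (deleteEdge G (W I) (W (suc I))) (W (suc I)) (W I) (J ∸ suc I)
  back = castʷ refl (trans (cong W (m+[n∸m]≡n I<J)) (sym WI≡WJ))
           (walkAlong (deleteEdge G (W I) (W (suc I))) W (suc I) (J ∸ suc I) along)

module _ {n : ℕ} {G : Graph n} (E : EdgeOnCycle G) where
  open EdgeOnCycle E

  u≢v : u ≢ v
  u≢v refl = subst T (Graph.irrefl G u) uv

  avoidEdge : ∀ {a b ℓ} → Walk G a b ℓ → ∃ λ ℓ′ → Walk (deleteEdge G u v) a b ℓ′
  avoidEdge here = 0 , here
  avoidEdge (step {u = x} {v = y} xy w) with isEdge? u v x y | avoidEdge w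
  ... | yes (inj₁ (refl , refl)) | _ , w′ = _ , reverseʷ back ++ʷ w′
  ... | yes (inj₂ (refl , refl)) | _ , w′ = _ , back ++ʷ w′
  ... | no  ¬e                   | _ , w′ = _ , step (deleteEdge-Adj⁺ {G = G} xy ¬e) w′

-- h x = min (d, distance from v to x in G − uv).
module Potential {n : ℕ} (G : Graph n) {d : ℕ} (girth : GirthAtLeast G (suc d))
                 (E : EdgeOnCycle G) where
  open EdgeOnCycle E

  G⁻ : Graph n
  G⁻ = deleteEdge G u v

  h : Fin n → ℕ
  h x = first (λ t → reachable≤ G⁻ v t x) d

  h≤d : ∀ x → h x ≤ d
  h≤d x = first-≤ _ d

  h-v : h v ≡ 0
  h-v = n≤0⇒n≡0 (first-minimal _ d {0} (⇒T-does (v ≟ v) refl))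

  h-Lipschitz : ∀ {x y} → Adj G⁻ x y → h y ≤ suc (h x)
  h-Lipschitz {x} xy with h x <? d
  ... | yes hx<d = first-minimal _ d (reachable≤-step G⁻ v (h x) (first-T _ d hx<d) xy)
  ... | no  hx≮d = ≤-trans (h≤d _) (≤-trans (≮⇒≥ hx≮d) (n≤1+n (h x)))

  -- A path from v to u in G − uv closes up with uv to a cycle of length at most h u + 1.
  h-u : h u ≡ d
  h-u with h u <? d
  ... | no  hu≮d = ≤-antisym (h≤d u) (≮⇒≥ hu≮d)
  ... | yes hu<d with reachable≤-sound G⁻ (h u) (first-T _ d hu<d)
  ...   | ℓ , ℓ≤hu , w with walk⇒path w
  ...     | ℓ′ , ℓ′≤ℓ , path , isPath = ⊥-elim (noShortPath path isPath (≤-trans ℓ′≤ℓ ℓ≤hu))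
    where
    noShortPath : ∀ {ℓ′} (p : Walk G⁻ v u ℓ′) → IsPath p → ℓ′ ≤ h u → ⊥
    noShortPath here                 _ _ = subst T (Graph.irrefl G u) uv
    noShortPath (step vu here)       _ _ = proj₂ (deleteEdge-Adj⁻ {G = G} vu) (inj₂ (refl , refl))
    noShortPath p@(step _ (step _ _)) isPath ℓ′≤hu =
      girth _ (s≤s (s≤s (s≤s z≤n))) (s≤s (<-≤-trans (s≤s ℓ′≤hu) hu<d))
        (path⇒cycle (deleteEdge-⊆ p) (deleteEdge-⊆-IsPath {G = G} {w = p} isPath) uv)

  h-intermediate : ∀ {a b ℓ} → Walk G⁻ a b ℓ → ∀ c → h a ≤ c → c ≤ h b → ∃ λ x → h x ≡ c
  h-intermediate {a} here       c ha≤c c≤hb = a , ≤-antisym ha≤c c≤hb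
  h-intermediate {a} (step e w) c ha≤c c≤hb with h a ≟ℕ c
  ... | yes ha≡c = a , ha≡c
  ... | no  ha≢c = h-intermediate w c (≤-trans (h-Lipschitz e) (≤∧≢⇒< ha≤c ha≢c)) c≤hb

  h-surjective : ∀ c → c ≤ d → ∃ λ x → h x ≡ c
  h-surjective c c≤d = h-intermediate back c (subst (_≤ c) (sym h-v) z≤n) (subst (c ≤_) (sym h-u) c≤d)

∣m+o-n+o∣≡∣m-n∣ : ∀ m n o → ∣ m + o - n + o ∣ ≡ ∣ m - n ∣
∣m+o-n+o∣≡∣m-n∣ m n o = trans (cong₂ ∣_-_∣ (+-comm m o) (+-comm n o)) (∣m+n-m+o∣≡∣n-o∣ o m n)

∣m-n∣≤1 : ∀ {m n} → m ≤ suc n → n ≤ suc m → ∣ m - n ∣ ≤ 1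
∣m-n∣≤1 {zero}  {zero}  _         _         = z≤n
∣m-n∣≤1 {zero}  {suc n} _         (s≤s n≤0) = s≤s n≤0
∣m-n∣≤1 {suc m} {zero}  (s≤s m≤0) _         = s≤s m≤0
∣m-n∣≤1 {suc m} {suc n} (s≤s m≤n) (s≤s n≤m) = ∣m-n∣≤1 m≤n n≤m

-- p and q lie within distance ℓ of each other on the cycle ℤ/Nℤ.
record WithinMod (N ℓ p q : ℕ) : Set where
  constructor within
  field
    s t       : ℕ
    distance≤ : ∣ p + s * N - q + t * N ∣ ≤ ℓ

module _ {N : ℕ} where

  within⇒withinMod : ∀ {ℓ p q} → ∣ p - q ∣ ≤ ℓ → WithinMod N ℓ p q
  within⇒withinMod {p = p} {q} ≤ℓ =
    within 0 0 (subst (_≤ _) (sym (cong₂ ∣_-_∣ (+-identityʳ p) (+-identityʳ q))) ≤ℓ)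

  withinMod-refl : ∀ {p} → WithinMod N 0 p p
  withinMod-refl {p} = within⇒withinMod {p = p} (≤-reflexive (∣n-n∣≡0 p))

  withinMod-sym : ∀ {ℓ p q} → WithinMod N ℓ p q → WithinMod N ℓ q p
  withinMod-sym {p = p} {q} (within s t ≤ℓ) =
    within t s (subst (_≤ _) (∣-∣-comm (p + s * N) (q + t * N)) ≤ℓ)

  withinMod-suc : ∀ {p q} t → q + t * N ≡ suc p → WithinMod N 1 p q
  withinMod-suc {p} {q} t q+tN≡1+p = within 0 t (≤-reflexive (begin
    ∣ p + 0 - q + t * N ∣  ≡⟨ cong₂ ∣_-_∣ (+-identityʳ p) (trans q+tN≡1+p (+-comm 1 p)) ⟩
    ∣ p - p + 1 ∣          ≡⟨ ∣m-m+n∣≡n p 1 ⟩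
    1                      ∎))
    where open ≡-Reasoning

  withinMod-trans : ∀ {a b p q r} → WithinMod N a p q → WithinMod N b q r → WithinMod N (a + b) p r
  withinMod-trans {a} {b} {p} {q} {r} (within s t pq) (within s′ t′ qr) = within (s + s′) (t′ + t) (begin
    ∣ p + (s + s′) * N - r + (t′ + t) * N ∣
      ≤⟨ ∣-∣-triangle (p + (s + s′) * N) (q + t * N + s′ * N) (r + (t′ + t) * N) ⟩
    ∣ p + (s + s′) * N - q + t * N + s′ * N ∣ + ∣ q + t * N + s′ * N - r + (t′ + t) * N ∣
      ≡⟨ cong₂ _+_ (trans (cong (∣_- q + t * N + s′ * N ∣) (e₁ p s s′))
                          (∣m+o-n+o∣≡∣m-n∣ (p + s * N) _ (s′ * N)))
                   (trans (cong₂ ∣_-_∣ (e₂ q t s′) (e₁ r t′ t))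
                          (∣m+o-n+o∣≡∣m-n∣ (q + s′ * N) _ (t * N))) ⟩
    ∣ p + s * N - q + t * N ∣ + ∣ q + s′ * N - r + t′ * N ∣
      ≤⟨ +-mono-≤ pq qr ⟩
    a + b ∎)
    where
    open ≤-Reasoning
    e₁ : ∀ x y z → x + (y + z) * N ≡ x + y * N + z * N
    e₁ x y z = solve 4 (λ x y z N → x :+ (y :+ z) :* N := x :+ y :* N :+ z :* N) refl x y z N
    e₂ : ∀ x y z → x + y * N + z * N ≡ x + z * N + y * N
    e₂ x y z = solve 4 (λ x y z N → x :+ y :* N :+ z :* N := x :+ z :* N :+ y :* N) refl x y z N

withinMod⇒sameLayer : ∀ {k g ℓ i j c} → ℓ < g → WithinMod (k * g) ℓ (i * g + c) (j * g + c) →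
                      i < k → j < k → i ≡ j
withinMod⇒sameLayer {zero}  _ _ () _
withinMod⇒sameLayer {k@(suc _)} {g} {ℓ} {i} {j} {c} ℓ<g (within s t ≤ℓ) i<k j<k = begin
  i                ≡⟨ m<n⇒m%n≡m i<k ⟨
  i % k            ≡⟨ [m+kn]%n≡m%n i s k ⟨
  (i + s * k) % k  ≡⟨ cong (_% k) (∣m-n∣≡0⇒m≡n {i + s * k} {j + t * k} (difference≡0 _ ≤ℓ′)) ⟩
  (j + t * k) % k  ≡⟨ [m+kn]%n≡m%n j t k ⟩
  j % k            ≡⟨ m<n⇒m%n≡m j<k ⟩
  j                ∎
  where
  open ≡-Reasoning
  regroup : ∀ x y → x * g + c + y * (k * g) ≡ (x + y * k) * g + c
  regroup x y =
    solve 5 (λ x y g c k → x :* g :+ c :+ y :* (k :* g) := (x :+ y :* k) :* g :+ c) refl x y g c k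
  ≤ℓ′ : ∣ i + s * k - j + t * k ∣ * g ≤ ℓ
  ≤ℓ′ = subst (_≤ ℓ) (begin
    ∣ i * g + c + s * (k * g) - j * g + c + t * (k * g) ∣  ≡⟨ cong₂ ∣_-_∣ (regroup i s) (regroup j t) ⟩
    ∣ (i + s * k) * g + c - (j + t * k) * g + c ∣          ≡⟨ ∣m+o-n+o∣≡∣m-n∣ ((i + s * k) * g) _ c ⟩
    ∣ (i + s * k) * g - (j + t * k) * g ∣                  ≡⟨ *-distribʳ-∣-∣ g (i + s * k) (j + t * k) ⟨
    ∣ i + s * k - j + t * k ∣ * g                          ∎) ≤ℓ
  difference≡0 : ∀ D → D * g ≤ ℓ → D ≡ 0
  difference≡0 zero    _     = refl
  difference≡0 (suc D) Dg≤ℓ = ⊥-elim (<⇒≱ ℓ<g (≤-trans (m≤m+n g (D * g)) Dg≤ℓ))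

r≤∣aN-r+bN∣ : ∀ {N r} a b → 2 * r ≤ N → r ≤ ∣ a * N - r + b * N ∣
r≤∣aN-r+bN∣ {N} {r} a b 2r≤N with a ≤? b
... | yes a≤b = +-cancelˡ-≤ (a * N) r _ (begin
  a * N + r                      ≡⟨ +-comm (a * N) r ⟩
  r + a * N                      ≤⟨ +-monoʳ-≤ r (*-monoˡ-≤ N a≤b) ⟩
  r + b * N                      ≤⟨ m≤n+∣n-m∣ (r + b * N) (a * N) ⟩
  a * N + ∣ a * N - r + b * N ∣  ∎)
  where open ≤-Reasoning
... | no  a≰b = +-cancelˡ-≤ (r + b * N) r _ (begin
  r + b * N + r                  ≡⟨ solve 3 (λ r b N → r :+ b :* N :+ r := b :* N :+ (r :+ (r :+ con 0)))
                                            refl r b N ⟩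
  b * N + 2 * r                  ≤⟨ +-monoʳ-≤ (b * N) 2r≤N ⟩
  b * N + N                      ≡⟨ +-comm (b * N) N ⟩
  suc b * N                      ≤⟨ *-monoˡ-≤ N (≰⇒> a≰b) ⟩
  a * N                          ≤⟨ m≤n+∣m-n∣ (a * N) (r + b * N) ⟩
  r + b * N + ∣ a * N - r + b * N ∣  ∎)
  where open ≤-Reasoning

¬withinMod-antipodal : ∀ {N r ℓ p q} t → 2 * r ≤ N → ℓ < r → q + t * N ≡ p + r → ¬ WithinMod N ℓ p q
¬withinMod-antipodal {N} {r} {ℓ} {p} {q} t 2r≤N ℓ<r q+tN≡p+r (within s t′ ≤ℓ) =
  <⇒≱ ℓ<r (≤-trans (r≤∣aN-r+bN∣ (s + t) t′ 2r≤N) (≤-trans (≤-reflexive distance) ≤ℓ))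
  where
  open ≡-Reasoning
  distance : ∣ (s + t) * N - r + t′ * N ∣ ≡ ∣ p + s * N - q + t′ * N ∣
  distance = begin
    ∣ (s + t) * N - r + t′ * N ∣                       ≡⟨ ∣m+n-m+o∣≡∣n-o∣ p _ _ ⟨
    ∣ p + (s + t) * N - p + (r + t′ * N) ∣             ≡⟨ cong₂ ∣_-_∣ (e₁ p s t) (e₂ p r t′) ⟩
    ∣ p + s * N + t * N - (p + r) + t′ * N ∣           ≡⟨ cong (λ x → ∣ p + s * N + t * N - x + t′ * N ∣)
                                                            q+tN≡p+r ⟨
    ∣ p + s * N + t * N - q + t * N + t′ * N ∣         ≡⟨ cong (∣ p + s * N + t * N -_∣) (e₃ q t t′) ⟩
    ∣ p + s * N + t * N - q + t′ * N + t * N ∣         ≡⟨ ∣m+o-n+o∣≡∣m-n∣ (p + s * N) (q + t′ * N) (t * N) ⟩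
    ∣ p + s * N - q + t′ * N ∣                         ∎
    where
    e₁ : ∀ x y z → x + (y + z) * N ≡ x + y * N + z * N
    e₁ x y z = solve 4 (λ x y z N → x :+ (y :+ z) :* N := x :+ y :* N :+ z :* N) refl x y z N
    e₂ : ∀ x y z → x + (y + z * N) ≡ x + y + z * N
    e₂ x y z = sym (+-assoc x y (z * N))
    e₃ : ∀ x y z → x + y * N + z * N ≡ x + z * N + y * N
    e₃ x y z = solve 4 (λ x y z N → x :+ y :* N :+ z :* N := x :+ z :* N :+ y :* N) refl x y z N

module Layers (k′ : ℕ) where

  next : Fin (suc k′) → Fin (suc k′)
  next i with toℕ i <? k′
  ... | yes i<k′ = fromℕ< (s≤s i<k′)
  ... | no  _    = zero

  prev : Fin (suc k′) → Fin (suc k′)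
  prev zero    = fromℕ k′
  prev (suc j) = inject₁ j

  prev-next : ∀ i → prev (next i) ≡ i
  prev-next i with toℕ i <? k′
  ... | yes i<k′ = toℕ-injective (trans (toℕ-inject₁ (fromℕ< i<k′)) (toℕ-fromℕ< i<k′))
  ... | no  i≮k′ = toℕ-injective (trans (toℕ-fromℕ k′) (≤-antisym (≮⇒≥ i≮k′) (s≤s⁻¹ (toℕ<n i))))

  next-prev : ∀ i → next (prev i) ≡ i
  next-prev zero with toℕ (fromℕ k′) <? k′
  ... | yes last<k′ = ⊥-elim (<-irrefl (toℕ-fromℕ k′) last<k′)
  ... | no  _       = refl
  next-prev (suc j) with toℕ (inject₁ j) <? k′
  ... | yes j<k′ = toℕ-injective (cong suc (trans (toℕ-fromℕ< j<k′) (toℕ-inject₁ j)))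
  ... | no  j≮k′ = ⊥-elim (j≮k′ (subst (_< k′) (sym (toℕ-inject₁ j)) (toℕ<n j)))

  next≡prev⇔ : ∀ {i j} → j ≡ next i ⇔ i ≡ prev j
  next≡prev⇔ {i} {j} = mk⇔ (λ { refl → sym (prev-next i) }) (λ { refl → sym (next-prev j) })

  toℕ-next : ∀ i → toℕ i < k′ → toℕ (next i) ≡ suc (toℕ i)
  toℕ-next i i<k′ with toℕ i <? k′
  ... | yes _    = cong suc (toℕ-fromℕ< _)
  ... | no  i≮k′ = ⊥-elim (i≮k′ i<k′)

  next-last : ∀ i → toℕ i ≡ k′ → next i ≡ zero
  next-last i i≡k′ with toℕ i <? k′
  ... | yes i<k′ = ⊥-elim (<-irrefl i≡k′ i<k′)
  ... | no  _    = refl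

-- The k-fold cyclic cover of G in which the edge u → v raises the layer by one (mod k) and
-- every other edge stays in its layer; the vertex (i , x) is combine i x.
module Cover {n : ℕ} (G : Graph n) (E : EdgeOnCycle G) (k′ : ℕ) where
  open EdgeOnCycle E
  open Layers k′

  k : ℕ
  k = suc k′

  shift : Fin k → Fin n → Fin n → Fin k
  shift i x y with x ≟ u ×-dec y ≟ v | x ≟ v ×-dec y ≟ u
  ... | yes _ | _     = next i
  ... | no  _ | yes _ = prev i
  ... | no  _ | no  _ = i

  shift-forward : ∀ i → shift i u v ≡ next i
  shift-forward i with u ≟ u ×-dec v ≟ v
  ... | yes _ = refl
  ... | no ¬e = ⊥-elim (¬e (refl , refl))

  shift-backward : ∀ i → shift i v u ≡ prev i
  shift-backward i with v ≟ u ×-dec u ≟ v | v ≟ v ×-dec u ≟ u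
  ... | yes (v≡u , _) | _     = ⊥-elim (u≢v E (sym v≡u))
  ... | no  _         | yes _ = refl
  ... | no  _         | no ¬e = ⊥-elim (¬e (refl , refl))

  shift-other : ∀ i {x y} → ¬ IsEdge u v x y → shift i x y ≡ i
  shift-other i {x} {y} ¬e with x ≟ u ×-dec y ≟ v | x ≟ v ×-dec y ≟ u
  ... | yes f | _     = ⊥-elim (¬e (inj₁ f))
  ... | no  _ | yes b = ⊥-elim (¬e (inj₂ b))
  ... | no  _ | no  _ = refl

  shift-sym : ∀ i j x y → j ≡ shift i x y ⇔ i ≡ shift j y x
  shift-sym i j x y with isEdge? u v x y
  ... | yes (inj₁ (refl , refl)) rewrite shift-forward i | shift-backward j = next≡prev⇔
  ... | yes (inj₂ (refl , refl)) rewrite shift-backward i | shift-forward j = ⇔-sym next≡prev⇔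
  ... | no ¬e rewrite shift-other i ¬e | shift-other j (¬e ∘ IsEdge-sym) = mk⇔ sym sym

  coverAdj : Fin k × Fin n → Fin k × Fin n → Bool
  coverAdj (i , x) (j , y) = adj G x y ∧ does (j ≟ shift i x y)

  cover : Graph (k * n)
  cover = record
    { adj    = λ w w′ → coverAdj (remQuot {k} n w) (remQuot {k} n w′)
    ; sym    = λ w w′ → symmetric (remQuot {k} n w) (remQuot {k} n w′)
    ; irrefl = λ w → irreflexive (remQuot {k} n w)
    }
    where
    irreflexive : ∀ a → coverAdj a a ≡ false
    irreflexive (i , x) rewrite Graph.irrefl G x = refl
    symmetric : ∀ a b → coverAdj a b ≡ coverAdj b a
    symmetric (i , x) (j , y) =
      cong₂ _∧_ (Graph.sym G x y) (does-⇔ (shift-sym i j x y) (j ≟ shift i x y) (i ≟ shift j y x))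

  layer : Fin (k * n) → Fin k
  layer w = proj₁ (remQuot {k} n w)

  point : Fin (k * n) → Fin n
  point w = proj₂ (remQuot {k} n w)

  combine-layer-point : ∀ w → combine (layer w) (point w) ≡ w
  combine-layer-point = combine-remQuot {k} n

  cover-Adj⁻ : ∀ {w w′} → Adj cover w w′ →
               Adj G (point w) (point w′) × layer w′ ≡ shift (layer w) (point w) (point w′)
  cover-Adj⁻ {w} {w′} ww′ with Equivalence.to T-∧ ww′
  ... | xy , j≡shift = xy , T-does⇒ (layer w′ ≟ shift (layer w) (point w) (point w′)) j≡shift

  adj-cover-combine : ∀ i x j y → adj cover (combine i x) (combine j y) ≡ adj G x y ∧ does (j ≟ shift i x y)
  adj-cover-combine i x j y = cong₂ coverAdj (remQuot-combine {k} {n} i x) (remQuot-combine {k} {n} j y)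

  cover-Adj⁺ : ∀ {i j x y} → Adj G x y → j ≡ shift i x y → Adj cover (combine i x) (combine j y)
  cover-Adj⁺ {i} {j} {x} {y} xy j≡shift =
    subst T (sym (adj-cover-combine i x j y))
            (Equivalence.from T-∧ (xy , ⇒T-does (j ≟ shift i x y) j≡shift))

  deg-cover-combine : ∀ i x → deg cover (combine i x) ≡ deg G x
  deg-cover-combine i x = begin
    deg cover (combine i x)
      ≡⟨ deg≡count cover (combine i x) ⟩
    sum (bit ∘ adj cover (combine i x))
      ≡⟨ sum-combine k (bit ∘ adj cover (combine i x)) ⟩
    sum {k} (λ j → sum {n} (λ y → bit (adj cover (combine i x) (combine j y))))
      ≡⟨ sum-cong-≗ {k} (λ j → sum-cong-≗ {n} (cong bit ∘ adj-cover-combine i x j)) ⟩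
    sum {k} (λ j → sum {n} (λ y → bit (adj G x y ∧ does (j ≟ shift i x y))))
      ≡⟨ ∑-comm (λ j y → bit (adj G x y ∧ does (j ≟ shift i x y))) ⟩
    sum (λ y → sum (λ j → bit (adj G x y ∧ does (j ≟ shift i x y))))
      ≡⟨ sum-cong-≗ {n} oneLiftPerNeighbour ⟩
    count (adj G x)
      ≡⟨ deg≡count G x ⟨
    deg G x
      ∎
    where
    open ≡-Reasoning
    oneLiftPerNeighbour : ∀ y → sum (λ j → bit (adj G x y ∧ does (j ≟ shift i x y))) ≡ bit (adj G x y)
    oneLiftPerNeighbour y with adj G x y
    ... | true  = count-≡ (shift i x y)
    ... | false = count-false k

  deg-cover : ∀ w → deg cover w ≡ deg G (point w)
  deg-cover w =
    trans (cong (deg cover) (sym (combine-layer-point w))) (deg-cover-combine (layer w) (point w))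

  cover-minDegree : ∀ {δ} → MinDegree G δ → MinDegree cover δ
  cover-minDegree {δ} ((x₀ , deg-x₀) , δ≤) =
    (combine {k} zero x₀ , trans (deg-cover-combine zero x₀) deg-x₀) ,
    λ w → subst (δ ≤_) (sym (deg-cover w)) (δ≤ (point w))

  layer-forward : ∀ {w w′} → Adj cover w w′ → point w ≡ u → point w′ ≡ v → layer w′ ≡ next (layer w)
  layer-forward {w} ww′ w↦u w′↦v =
    trans (proj₂ (cover-Adj⁻ ww′)) (trans (cong₂ (shift (layer w)) w↦u w′↦v) (shift-forward (layer w)))

  layer-other : ∀ {w w′} → Adj cover w w′ → ¬ IsEdge u v (point w) (point w′) → layer w′ ≡ layer w
  layer-other {w} ww′ ¬e = trans (proj₂ (cover-Adj⁻ ww′)) (shift-other (layer w) ¬e)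

  liftWithinLayer : ∀ i {x y ℓ} → Walk (deleteEdge G u v) x y ℓ → Walk cover (combine i x) (combine i y) ℓ
  liftWithinLayer i here       = here
  liftWithinLayer i (step xy w) with deleteEdge-Adj⁻ {G = G} xy
  ... | Gxy , ¬e = step (cover-Adj⁺ Gxy (sym (shift-other i ¬e))) (liftWithinLayer i w)

  module _ (connected : Connected G) where

    withinLayer : ∀ (i : Fin k) x y → ∃ λ ℓ → Walk cover (combine i x) (combine i y) ℓ
    withinLayer i x y = _ , liftWithinLayer i (proj₂ (avoidEdge E (proj₂ (connected x y))))

    fromBase : ∀ t (t<k : t < k) x → ∃ λ ℓ → Walk cover (combine {k} zero u) (combine (fromℕ< t<k) x) ℓ
    fromBase zero    _     x = withinLayer zero u x
    fromBase (suc t) 1+t<k x =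
      _ , proj₂ (fromBase t t<k u) ++ʷ step climb (proj₂ (withinLayer (fromℕ< 1+t<k) v x))
      where
      t<k : t < k
      t<k = <-trans (n<1+n t) 1+t<k
      next-t : next (fromℕ< t<k) ≡ fromℕ< 1+t<k
      next-t = toℕ-injective (trans (toℕ-next _ (subst (_< k′) (sym (toℕ-fromℕ< t<k)) (s≤s⁻¹ 1+t<k)))
                                    (trans (cong suc (toℕ-fromℕ< t<k)) (sym (toℕ-fromℕ< 1+t<k))))
      climb : Adj cover (combine (fromℕ< t<k) u) (combine (fromℕ< 1+t<k) v)
      climb = cover-Adj⁺ uv (trans (sym next-t) (sym (shift-forward _)))

    reachableFromBase : ∀ w → ∃ λ ℓ → Walk cover (combine {k} zero u) w ℓ
    reachableFromBase w with fromBase (toℕ (layer w)) (toℕ<n _) (point w)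
    ... | ℓ , walk = ℓ , castʷ refl onLayer walk
      where
      onLayer : combine (fromℕ< (toℕ<n (layer w))) (point w) ≡ w
      onLayer = trans (cong (λ j → combine j (point w)) (fromℕ<-toℕ (layer w) (toℕ<n _)))
                      (combine-layer-point w)

    cover-connected : Connected cover
    cover-connected w w′ with reachableFromBase w | reachableFromBase w′
    ... | _ , toW | _ , toW′ = _ , reverseʷ toW ++ʷ toW′

-- Vertex (i , x) of the cover sits at position i g + h x of ℤ/Nℤ, N = k g; an edge moves
-- the position by at most 1 because the edge u → v goes from h = d in layer i to h = 0
-- in layer i + 1.
module CoverGeometry {n : ℕ} (G : Graph n) {d : ℕ} (girth : GirthAtLeast G (suc d))
                     (E : EdgeOnCycle G) (k′ : ℕ) where
  open EdgeOnCycle E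
  open Layers k′
  open Cover G E k′
  open Potential G girth E

  g : ℕ
  g = suc d

  N : ℕ
  N = k * g

  position : Fin (k * n) → ℕ
  position w = toℕ (layer w) * g + h (point w)

  position-u : ∀ {w} → point w ≡ u → position w ≡ toℕ (layer w) * g + d
  position-u {w} w↦u = cong (toℕ (layer w) * g +_) (trans (cong h w↦u) h-u)

  position-v : ∀ {w} → point w ≡ v → position w ≡ toℕ (layer w) * g + 0
  position-v {w} w↦v = cong (toℕ (layer w) * g +_) (trans (cong h w↦v) h-v)

  forward-withinMod : ∀ {w w′} → Adj cover w w′ → point w ≡ u → point w′ ≡ v →
                      WithinMod N 1 (position w) (position w′)
  forward-withinMod {w} {w′} ww′ w↦u w′↦v with m≤n⇒m<n∨m≡n (s≤s⁻¹ (toℕ<n (layer w)))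
  ... | inj₁ i<k′ = withinMod-suc 0 (begin
    position w′ + 0 * N               ≡⟨ +-identityʳ _ ⟩
    position w′                       ≡⟨ position-v w′↦v ⟩
    toℕ (layer w′) * g + 0            ≡⟨ cong (λ j → toℕ j * g + 0) (layer-forward ww′ w↦u w′↦v) ⟩
    toℕ (next (layer w)) * g + 0      ≡⟨ cong (λ t → t * g + 0) (toℕ-next _ i<k′) ⟩
    suc (toℕ (layer w)) * g + 0       ≡⟨ solve 2 (λ t d → (con 1 :+ t) :* (con 1 :+ d) :+ con 0
                                                      := con 1 :+ (t :* (con 1 :+ d) :+ d))
                                                 refl (toℕ (layer w)) d ⟩
    suc (toℕ (layer w) * g + d)       ≡⟨ cong suc (position-u w↦u) ⟨
    suc (position w)                  ∎)
    where open ≡-Reasoning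
  ... | inj₂ i≡k′ = withinMod-suc 1 (begin
    position w′ + 1 * N               ≡⟨ cong (_+ 1 * N) (position-v w′↦v) ⟩
    toℕ (layer w′) * g + 0 + 1 * N    ≡⟨ cong (λ j → toℕ j * g + 0 + 1 * N)
                                             (trans (layer-forward ww′ w↦u w′↦v) (next-last _ i≡k′)) ⟩
    0 * g + 0 + 1 * N                 ≡⟨ solve 2 (λ k′ d → con 1 :* ((con 1 :+ k′) :* (con 1 :+ d))
                                                      := con 1 :+ (k′ :* (con 1 :+ d) :+ d)) refl k′ d ⟩
    suc (k′ * g + d)                  ≡⟨ cong (λ t → suc (t * g + d)) i≡k′ ⟨
    suc (toℕ (layer w) * g + d)       ≡⟨ cong suc (position-u w↦u) ⟨
    suc (position w)                  ∎)
    where open ≡-Reasoning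

  Adj-withinMod : ∀ {w w′} → Adj cover w w′ → WithinMod N 1 (position w) (position w′)
  Adj-withinMod {w} {w′} ww′ with isEdge? u v (point w) (point w′)
  ... | yes (inj₁ (w↦u , w′↦v)) = forward-withinMod ww′ w↦u w′↦v
  ... | yes (inj₂ (w↦v , w′↦u)) = withinMod-sym (forward-withinMod (Adj-sym cover ww′) w′↦u w↦v)
  ... | no ¬e = within⇒withinMod (subst (_≤ 1) (sym sameLayer) (∣m-n∣≤1 (h-Lipschitz yx) (h-Lipschitz xy)))
    where
    xy : Adj G⁻ (point w) (point w′)
    xy = deleteEdge-Adj⁺ {G = G} (proj₁ (cover-Adj⁻ ww′)) ¬e
    yx : Adj G⁻ (point w′) (point w)
    yx = Adj-sym G⁻ xy
    sameLayer : ∣ position w - position w′ ∣ ≡ ∣ h (point w) - h (point w′) ∣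
    sameLayer = trans (cong (λ j → ∣ position w - toℕ j * g + h (point w′) ∣) (layer-other ww′ ¬e))
                      (∣m+n-m+o∣≡∣n-o∣ (toℕ (layer w) * g) _ _)

  walk-withinMod : ∀ {w w′ ℓ} → Walk cover w w′ ℓ → WithinMod N ℓ (position w) (position w′)
  walk-withinMod here        = withinMod-refl
  walk-withinMod (step e ws) = withinMod-trans (Adj-withinMod e) (walk-withinMod ws)

  cover-girth : GirthAtLeast cover g
  cover-girth m 3≤1+m 1+m<g C with injective⊎collision (point ∘ Cycle.vtx C)
  ... | inj₁ injective = girth m 3≤1+m 1+m<g record
    { vtx   = point ∘ Cycle.vtx C
    ; inj   = injective
    ; step  = proj₁ ∘ cover-Adj⁻ ∘ Cycle.step C
    ; close = proj₁ (cover-Adj⁻ (Cycle.close C))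
    }
  ... | inj₂ (i , j , i<j , samePoint) = <-irrefl (cong toℕ (Cycle.inj C sameVertex)) i<j
    where
    open Cycle C using (vtx)
    L<g : toℕ j ∸ toℕ i < g
    L<g = ≤-trans (s≤s (≤-trans (m∸n≤m (toℕ j) (toℕ i)) (s≤s⁻¹ (toℕ<n j)))) (<⇒≤ 1+m<g)
    nearby : WithinMod N (toℕ j ∸ toℕ i) (toℕ (layer (vtx i)) * g + h (point (vtx i)))
                                         (toℕ (layer (vtx j)) * g + h (point (vtx i)))
    nearby = subst (λ x → WithinMod N _ _ (toℕ (layer (vtx j)) * g + h x)) (sym samePoint)
                   (walk-withinMod (cycle-segment C i j (<⇒≤ i<j)))
    sameLayer : layer (vtx i) ≡ layer (vtx j)
    sameLayer = toℕ-injective (withinMod⇒sameLayer L<g nearby (toℕ<n _) (toℕ<n _))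
    sameVertex : vtx i ≡ vtx j
    sameVertex = trans (sym (combine-layer-point _))
                       (trans (cong₂ combine sameLayer samePoint) (combine-layer-point _))

  position-combine : ∀ i x → position (combine i x) ≡ toℕ i * g + h x
  position-combine i x = cong (λ (j , y) → toℕ j * g + h y) (remQuot-combine {k} {n} i x)

  position-surjective : ∀ q → q < N → ∃ λ w → position w ≡ q
  position-surjective q q<N with h-surjective (q % g) (s≤s⁻¹ (m%n<n q g))
  ... | x , hx≡q%g = combine (fromℕ< q/g<k) x , (begin
    position (combine (fromℕ< q/g<k) x)  ≡⟨ position-combine (fromℕ< q/g<k) x ⟩
    toℕ (fromℕ< q/g<k) * g + h x         ≡⟨ cong₂ (λ a b → a * g + b) (toℕ-fromℕ< q/g<k) hx≡q%g ⟩
    q / g * g + q % g                    ≡⟨ +-comm (q / g * g) (q % g) ⟩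
    q % g + q / g * g                    ≡⟨ m≡m%n+[m/n]*n q g ⟨
    q                                    ∎)
    where
    open ≡-Reasoning
    q/g<k : q / g < k
    q/g<k = m<n*o⇒m/o<n {q} {k} {g} q<N

  cover-radius : ∀ {r} → 2 * r ≤ N → RadiusAtLeast cover r
  cover-radius {r} 2r≤N a with position-surjective ((position a + r) % N) (m%n<n (position a + r) N)
  ... | w , w↦target = w , λ ℓ ℓ<r walk →
    ¬withinMod-antipodal ((position a + r) / N) 2r≤N ℓ<r antipodal (walk-withinMod walk)
    where
    antipodal : position w + (position a + r) / N * N ≡ position a + r
    antipodal = trans (cong (_+ (position a + r) / N * N) w↦target)
                      (sym (m≡m%n+[m/n]*n (position a + r) N))

cyclicCover : ∀ {f δ d r} k′ (G : Graph f) → Connected G → GirthAtLeast G (suc d) → MinDegree G δ →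
  2 ≤ δ → 2 * r ≤ suc k′ * suc d →
  Σ (Graph (suc k′ * f)) λ H → Connected H × GirthAtLeast H (suc d) × MinDegree H δ × RadiusAtLeast H r
cyclicCover k′ G connected girth minDegree@((x₀ , _) , δ≤) 2≤δ 2r≤N =
  cover , cover-connected connected , cover-girth , cover-minDegree minDegree , cover-radius 2r≤N
  where
  E : EdgeOnCycle G
  E = edgeOnCycle G (λ x → ≤-trans 2≤δ (δ≤ x)) x₀
  open Cover G E k′
  open CoverGeometry G girth E k′

ceilDiv-spec : ∀ a d → a ≤ ceilDiv a (suc d) * suc d
ceilDiv-spec a d = +-cancelʳ-≤ d a _ (begin
  a + d                                           ≡⟨ m≡m%n+[m/n]*n (a + d) (suc d) ⟩
  (a + d) % suc d + (a + d) / suc d * suc d        ≤⟨ +-monoˡ-≤ _ (s≤s⁻¹ (m%n<n (a + d) (suc d))) ⟩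
  d + (a + d) / suc d * suc d                     ≡⟨ +-comm d _ ⟩
  (a + d) / suc d * suc d + d                     ∎)
  where open ≤-Reasoning

ceilDiv-positive : ∀ {a} d → 1 ≤ a → 1 ≤ ceilDiv a (suc d)
ceilDiv-positive {a} d 1≤a with ceilDiv a (suc d) | ceilDiv-spec a d
... | zero  | a≤0 = ⊥-elim (<⇒≱ 1≤a a≤0)
... | suc _ | _   = s≤s z≤n

proposition4p1 : ∀ (g δ r f : ℕ) → 2 ≤ δ → 3 ≤ g → IsF g δ f → g < 2 * r →
  Σ (Graph (ceilDiv (2 * r) g * f)) λ G →
    Connected G × GirthAtLeast G g × MinDegree G δ × RadiusAtLeast G r
proposition4p1 zero    _ _ _ _   ()
proposition4p1 (suc d) δ r f 2≤δ _ ((G , girth , minDegree) , minimal) g<2r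
  with ceilDiv (2 * r) (suc d) | ceilDiv-positive d (≤-trans (s≤s z≤n) g<2r) | ceilDiv-spec (2 * r) d
... | zero   | ()  | _
... | suc k′ | _   | 2r≤N =
  cyclicCover k′ G (minimal⇒connected G girth minDegree minimal) girth minDegree 2≤δ 2r≤N
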